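{- Let $P$ be a p-string with $\Pi_P\neq\emptyset$, let $p\in\mathbb{N}^+$ with $p\le|P|$, and let $r=\mathrm{reach}_P(p)$, assuming $r>p$. Then there is no prefix period $q$ of $P$ with $p<q<p+\mathrm{period}(P[0:r-p])$.
   Context: Let $\Sigma$ and $\Pi$ be disjoint alphabets; a p-string is a string over $\Sigma\cup\Pi$, indexed from 0, with $w[i:j]=w[i]\cdots w[j-1]$. A permutation $f$ of $\Pi$ acts on p-strings letterwise, fixing letters of $\Sigma$; $x\equiv y$ iff $f(x)=y$ for some permutation $f$ of $\Pi$. For $p\in\mathbb{N}^+$, $p\le|w|$, $p$ is a period of $w$ iff $w[0:|w|-p]\equiv w[p:|w|]$; $\mathrm{period}(w)$ is the smallest period of a nonempty $w$. $\Pi_P$ is the set of parameter characters occurring in $P$. With $k=|\Pi_P|+2$, a positive integer $q$ is a prefix period of $P$ iff there is a prefix $w'$ of $P$ with $\mathrm{period}(w')=q$ and $q\le|w'|/k$. For $0<p\le|P|$, $\mathrm{reach}_P(p)=\max\{r\in\mathbb{N}: r\le|P| \text{ and } p \text{ is a period of } P[0:r]\}$. -}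

module Defs where

open import Data.Nat using (ℕ; zero; suc; _+_; _*_; _∸_; _≤_; _<_)
open import Data.List using (List; length; take; drop; map; mapMaybe; deduplicate)
open import Data.List.Membership.Propositional using (_∈_)
open import Data.Sum using (_⊎_; inj₁; inj₂)
open import Data.Maybe using (Maybe; just; nothing)
open import Data.Product using (Σ; ∃; _×_; _,_)
open import Function.Bundles using (_↔_; Inverse)
open import Relation.Binary.PropositionalEquality using (_≡_)
open import Relation.Binary.Definitions using (DecidableEquality)

-- Parameterised p-strings: Σ-letters are `S`, Π-letters are `T` (disjoint via ⊎).
module PString (S T : Set) (_≟T_ : DecidableEquality T) where

  PStr : Set
  PStr = List (S ⊎ T)

  act : (T ↔ T) → S ⊎ T → S ⊎ T
  act f (inj₁ s) = inj₁ s
  act f (inj₂ t) = inj₂ (Inverse.to f t)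

  _≈ₚ_ : PStr → PStr → Set
  x ≈ₚ y = Σ (T ↔ T) λ f → map (act f) x ≡ y

  IsPeriod : ℕ → PStr → Set
  IsPeriod p w = (0 < p) × (p ≤ length w) × (take (length w ∸ p) w ≈ₚ drop p w)

  IsSmallestPeriod : ℕ → PStr → Set
  IsSmallestPeriod q w = IsPeriod q w × (∀ p → IsPeriod p w → q ≤ p)

  paramOf : S ⊎ T → Maybe T
  paramOf (inj₁ _) = nothing
  paramOf (inj₂ t) = just t

  ΠOf : PStr → List T
  ΠOf P = deduplicate _≟T_ (mapMaybe paramOf P)

  kOf : PStr → ℕ
  kOf P = length (ΠOf P) + 2

  -- q is a prefix period of P: some prefix w' = P[0:n] has period(w') = q and q ≤ |w'|/k,
  -- i.e. q * k ≤ |w'|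
  IsPrefixPeriod : PStr → ℕ → Set
  IsPrefixPeriod P q = ∃ λ n → n ≤ length P × IsSmallestPeriod q (take n P)
                               × q * kOf P ≤ length (take n P)

  IsReach : PStr → ℕ → ℕ → Set
  IsReach P p r = (r ≤ length P) × IsPeriod p (take r P)
                × (∀ r' → r' ≤ length P → IsPeriod p (take r' P) → r' ≤ r)

{-# OPTIONS --safe #-}
-- If q were a prefix period of P with p < q < p + period(P[0:r-p]), take a prefix P[0:n] whose
-- smallest period is q. When n ≤ r, p is already a period of P[0:n], contradicting p < q. When
-- n > r, q < r, so p and q are both periods of P[0:r]; their difference q - p is then a period of
-- P[p:r] ≈ P[0:r-p], contradicting q - p < period(P[0:r-p]).
module Submission where

open import Defs
open import Data.Nat using (ℕ; _+_; _∸_; _≤_; _<_)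
open import Data.Nat.Properties
open import Data.List using (List; length; take; drop; map)
open import Data.List.Properties
open import Data.List.Membership.Propositional using (_∈_)
open import Data.Sum using (_⊎_; inj₁; inj₂)
open import Data.Product using (∃; _,_)
open import Data.Empty using (⊥)
open import Function.Bundles using (Inverse)
open import Function.Properties.Inverse using (↔-refl; ↔-sym; ↔-trans)
open import Relation.Binary.Bundles using (Setoid)
open import Relation.Binary.Definitions using (DecidableEquality)
open import Relation.Binary.PropositionalEquality
open import Relation.Nullary using (yes; no)

length-take-≤ : ∀ {A : Set} {n} (xs : List A) → n ≤ length xs → length (take n xs) ≡ n
length-take-≤ {n = n} xs n≤ = trans (length-take n xs) (m≤n⇒m⊓n≡m n≤)

take-take-≤ : ∀ {A : Set} {m n} (xs : List A) → m ≤ n → take m (take n xs) ≡ take m xs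
take-take-≤ {m = m} {n} xs m≤n = trans (take-take m n xs) (cong (λ j → take j xs) (m≤n⇒m⊓n≡m m≤n))

module PStringProperties (S T : Set) (_≟T_ : DecidableEquality T) where
  open PString S T _≟T_

  act-id : ∀ x → act ↔-refl x ≡ x
  act-id (inj₁ s) = refl
  act-id (inj₂ t) = refl

  act-trans : ∀ f g x → act (↔-trans f g) x ≡ act g (act f x)
  act-trans f g (inj₁ s) = refl
  act-trans f g (inj₂ t) = refl

  act-sym : ∀ f x → act (↔-sym f) (act f x) ≡ x
  act-sym f (inj₁ s) = refl
  act-sym f (inj₂ t) = cong inj₂ (Inverse.strictlyInverseʳ f t)

  ≈ₚ-refl : ∀ {x} → x ≈ₚ x
  ≈ₚ-refl {x} = ↔-refl , trans (map-cong act-id x) (map-id x)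

  ≈ₚ-sym : ∀ {x y} → x ≈ₚ y → y ≈ₚ x
  ≈ₚ-sym {x} (f , refl) = ↔-sym f , trans (sym (map-∘ x)) (trans (map-cong (act-sym f) x) (map-id x))

  ≈ₚ-trans : ∀ {x y z} → x ≈ₚ y → y ≈ₚ z → x ≈ₚ z
  ≈ₚ-trans {x} (f , refl) (g , refl) = ↔-trans f g , trans (map-cong (act-trans f g) x) (map-∘ x)

  ≈ₚ-setoid : Setoid _ _
  ≈ₚ-setoid = record
    { Carrier       = PStr
    ; _≈_           = _≈ₚ_
    ; isEquivalence = record { refl = ≈ₚ-refl ; sym = ≈ₚ-sym ; trans = ≈ₚ-trans }
    }

  ≈ₚ-length : ∀ {x y} → x ≈ₚ y → length x ≡ length y
  ≈ₚ-length {x} (f , refl) = sym (length-map (act f) x)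

  ≈ₚ-take : ∀ n {x y} → x ≈ₚ y → take n x ≈ₚ take n y
  ≈ₚ-take n {x} (f , refl) = f , sym (take-map n x)

  ≈ₚ-drop : ∀ n {x y} → x ≈ₚ y → drop n x ≈ₚ drop n y
  ≈ₚ-drop n {x} (f , refl) = f , sym (drop-map n x)

  isPeriod-intro : ∀ {p w L} → length w ≡ L → 0 < p → p ≤ L →
                   take (L ∸ p) w ≈ₚ drop p w → IsPeriod p w
  isPeriod-intro refl 0<p p≤L shift = 0<p , p≤L , shift

  isPeriod-≈ₚ : ∀ {d x y} → x ≈ₚ y → IsPeriod d y → IsPeriod d x
  isPeriod-≈ₚ {d} {x} {y} x≈y (0<d , d≤L , shift) =
    isPeriod-intro (≈ₚ-length x≈y) 0<d d≤L (begin
      take (length y ∸ d) x  ≈⟨ ≈ₚ-take _ x≈y ⟩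
      take (length y ∸ d) y  ≈⟨ shift ⟩
      drop d y               ≈⟨ ≈ₚ-drop d (≈ₚ-sym x≈y) ⟩
      drop d x               ∎)
    where open import Relation.Binary.Reasoning.Setoid ≈ₚ-setoid

  isPeriod-take : ∀ {p n w} → IsPeriod p w → p ≤ n → n ≤ length w → IsPeriod p (take n w)
  isPeriod-take {p} {n} {w} (0<p , _ , shift) p≤n n≤L =
    isPeriod-intro (length-take-≤ w n≤L) 0<p p≤n (begin
      take (n ∸ p) (take n w)                ≡⟨ take-take-≤ w (m∸n≤m n p) ⟩
      take (n ∸ p) w                         ≡⟨ sym (take-take-≤ w (∸-monoˡ-≤ p n≤L)) ⟩
      take (n ∸ p) (take (length w ∸ p) w)   ≈⟨ ≈ₚ-take (n ∸ p) shift ⟩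
      take (n ∸ p) (drop p w)                ≡⟨ take-drop (n ∸ p) p w ⟩
      drop p (take (p + (n ∸ p)) w)          ≡⟨ cong (λ j → drop p (take j w)) (m+[n∸m]≡n p≤n) ⟩
      drop p (take n w)                      ∎)
    where open import Relation.Binary.Reasoning.Setoid ≈ₚ-setoid

  isPeriod-take-take : ∀ {p m n w} → IsPeriod p (take n w) → p ≤ m → m ≤ n → n ≤ length w →
                       IsPeriod p (take m w)
  isPeriod-take-take {w = w} per p≤m m≤n n≤L =
    subst (IsPeriod _) (take-take-≤ w m≤n)
          (isPeriod-take per p≤m (≤-trans m≤n (≤-reflexive (sym (length-take-≤ w n≤L)))))

  isPeriod-drop-∸ : ∀ {p q w} → IsPeriod p w → IsPeriod q w → p < q → IsPeriod (q ∸ p) (drop p w)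
  isPeriod-drop-∸ {p} {q} {w} (_ , _ , shiftₚ) (_ , q≤L , shiftq) p<q =
    isPeriod-intro (length-drop p w) (m<n⇒0<n∸m p<q) (∸-monoˡ-≤ p q≤L) (begin
      take (L ∸ p ∸ (q ∸ p)) (drop p w)    ≡⟨ cong (λ j → take j (drop p w)) L∸p∸[q∸p]≡L∸q ⟩
      take (L ∸ q) (drop p w)              ≈⟨ ≈ₚ-take (L ∸ q) (≈ₚ-sym shiftₚ) ⟩
      take (L ∸ q) (take (L ∸ p) w)        ≡⟨ take-take-≤ w (∸-monoʳ-≤ L (<⇒≤ p<q)) ⟩
      take (L ∸ q) w                       ≈⟨ shiftq ⟩
      drop q w                             ≡⟨ cong (λ j → drop j w) (sym (m+[n∸m]≡n (<⇒≤ p<q))) ⟩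
      drop (p + (q ∸ p)) w                 ≡⟨ sym (drop-drop p (q ∸ p) w) ⟩
      drop (q ∸ p) (drop p w)              ∎)
    where
    open import Relation.Binary.Reasoning.Setoid ≈ₚ-setoid
    L = length w
    L∸p∸[q∸p]≡L∸q : L ∸ p ∸ (q ∸ p) ≡ L ∸ q
    L∸p∸[q∸p]≡L∸q = trans (∸-+-assoc L p (q ∸ p)) (cong (L ∸_) (m+[n∸m]≡n (<⇒≤ p<q)))

  isPeriod-take-∸ : ∀ {p q r w} → IsPeriod p (take r w) → IsPeriod q (take r w) → p < q → r ≤ length w →
                    IsPeriod (q ∸ p) (take (r ∸ p) w)
  isPeriod-take-∸ {p} {q} {r} {w} perₚ@(_ , _ , shiftₚ) perq p<q r≤L =
    subst (IsPeriod (q ∸ p)) prefix (isPeriod-≈ₚ shiftₚ (isPeriod-drop-∸ perₚ perq p<q))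
    where
    prefix : take (length (take r w) ∸ p) (take r w) ≡ take (r ∸ p) w
    prefix = trans (cong (λ L → take (L ∸ p) (take r w)) (length-take-≤ w r≤L))
                   (take-take-≤ w (m∸n≤m r p))

  isPeriod⇒≤-length : ∀ {p n w} → IsPeriod p (take n w) → n ≤ length w → p ≤ n
  isPeriod⇒≤-length {w = w} (_ , p≤L , _) n≤L = subst (_ ≤_) (length-take-≤ w n≤L) p≤L

lemma16 : (S T : Set) (_≟T_ : DecidableEquality T) →
    let open PString S T _≟T_ in
    (P : List (S ⊎ T)) → (∃ λ t → inj₂ t ∈ P) →
    (p : ℕ) → 0 < p → p ≤ length P →
    (r : ℕ) → IsReach P p r → p < r →
    (m : ℕ) → IsSmallestPeriod m (take (r ∸ p) P) →
    (q : ℕ) → IsPrefixPeriod P q → p < q → q < p + m → ⊥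
lemma16 S T _≟T_ P _ p _ _ r (r≤P , perₚ , _) p<r m (perₘ , m-min) q (n , n≤P , (perq , q-min) , _) p<q q<p+m
  with n ≤? r
... | yes n≤r = <⇒≱ p<q (q-min p (isPeriod-take-take perₚ p≤n n≤r r≤P))
  where
  open PStringProperties S T _≟T_
  p≤n : p ≤ n
  p≤n = <⇒≤ (<-≤-trans p<q (isPeriod⇒≤-length perq n≤P))
... | no n≰r = <⇒≱ q<p+m (begin
    p + m        ≤⟨ +-monoʳ-≤ p (m-min (q ∸ p) (isPeriod-take-∸ perₚ perq-r p<q r≤P)) ⟩
    p + (q ∸ p)  ≡⟨ m+[n∸m]≡n (<⇒≤ p<q) ⟩
    q            ∎)
  where
  open PStringProperties S T _≟T_
  open ≤-Reasoning
  q<r : q < r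
  q<r = begin-strict
    q            <⟨ q<p+m ⟩
    p + m        ≤⟨ +-monoʳ-≤ p (isPeriod⇒≤-length perₘ (≤-trans (m∸n≤m r p) r≤P)) ⟩
    p + (r ∸ p)  ≡⟨ m+[n∸m]≡n (<⇒≤ p<r) ⟩
    r            ∎
  perq-r : PString.IsPeriod S T _≟T_ q (take r P)
  perq-r = isPeriod-take-take perq (<⇒≤ q<r) (<⇒≤ (≰⇒> n≰r)) n≤P
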